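{- Let $k$ be a positive integer and let $G$ be a complete $q$-partite graph ($q\ge 2$) whose parts have orders $n_1 \geq n_2 \geq \cdots \geq n_q$. Then \[ \mathrm{MOF}_k(G) \geq n_1 + \sum_{i=2}^q \max\{n_i-k,0\}. \]
   Context: A complete $q$-partite graph has its vertex set partitioned into $q\ge 2$ independent sets (parts), with every edge between vertices in different parts present. An orientation of $G$ assigns to each edge $\{u,v\}$ exactly one of the arcs $(u,v)$ or $(v,u)$; if $(u,v)$ is an arc, $v$ is an out-neighbor of $u$. Oriented $k$-forcing: given an orientation $D$ and a set $S$ of initially colored vertices, any colored vertex having at most $k$ non-colored out-neighbors forces all of them to become colored; this rule is applied iteratively as long as possible. $S$ is an oriented $k$-forcing set if at the end every vertex is colored. $F_k(D)$ is the minimum size of such a set, and $\mathrm{MOF}_k(G)$ is the maximum of $F_k(D)$ over all orientations $D$ of $G$. -}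

module Defs where

open import Data.Nat using (ℕ; zero; suc; _≤_; _∸_; _+_)
open import Data.Fin using (Fin)
import Data.Fin as F
open import Data.Bool using (Bool; true; false; not; _∧_; _∨_)
open import Data.List using (List; map; allFin)
open import Data.Nat.ListAction using (sum)
import Data.Bool
open import Relation.Nullary using (does)
open import Data.Product using (Σ; _×_; ∃)
open import Relation.Binary.PropositionalEquality using (_≡_; _≢_)
open import Relation.Binary.Construct.Closure.ReflexiveTransitive using (Star)

Σᶠ : (m : ℕ) → (Fin m → ℕ) → ℕ
Σᶠ m f = sum (map f (allFin m))

Bool→ℕ : Bool → ℕ
Bool→ℕ true  = 1
Bool→ℕ false = 0

card : {N : ℕ} → (Fin N → Bool) → ℕ
card {N} P = Σᶠ N (λ v → Bool→ℕ (P v))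

-- A complete multipartite graph on vertex set Fin N is determined by the
-- part map  part : Fin N → Fin q ; u v adjacent iff part u ≢ part v.
-- Part i has order n i:
HasPartSizes : {N q : ℕ} → (Fin N → Fin q) → (Fin q → ℕ) → Set
HasPartSizes {N} {q} part n =
  (i : Fin q) → card (λ v → does (part v F.≟ i)) ≡ n i

-- An orientation of the complete multipartite graph given by `part`:
-- D u v ≡ true means (u,v) is an arc.  Arcs only join adjacent vertices,
-- and every edge receives exactly one direction.
IsOrientation : {N q : ℕ} → (Fin N → Fin q) → (Fin N → Fin N → Bool) → Set
IsOrientation part D =
  (∀ u v → D u v ≡ true → part u ≢ part v) ×
  (∀ u v → part u ≢ part v → D u v ≡ not (D v u))

uncoloredOut : {N : ℕ} → (Fin N → Fin N → Bool) → (Fin N → Bool) → Fin N → ℕ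
uncoloredOut D C u = card (λ v → D u v ∧ not (C v))

force : {N : ℕ} → (Fin N → Fin N → Bool) → (Fin N → Bool) → Fin N → (Fin N → Bool)
force D C u v = C v ∨ D u v

ForceStep : {N : ℕ} → ℕ → (Fin N → Fin N → Bool) → (Fin N → Bool) → (Fin N → Bool) → Set
ForceStep k D C C′ =
  ∃ λ u → (C u ≡ true) × (uncoloredOut D C u ≤ k) × (C′ ≡ force D C u)

-- S is an oriented k-forcing set of D: repeated application of the rule
-- can colour every vertex.  (The rule is monotone, so the final colouring
-- of the iterated process is independent of the order of applications.)
IsForcingSet : {N : ℕ} → ℕ → (Fin N → Fin N → Bool) → (Fin N → Bool) → Set
IsForcingSet k D S =
  ∃ λ C → Star (ForceStep k D) S C × (∀ v → C v ≡ true)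

-- m ≤ F_k(D): every oriented k-forcing set of D has at least m vertices.
FkAtLeast : {N : ℕ} → ℕ → (Fin N → Fin N → Bool) → ℕ → Set
FkAtLeast k D m = ∀ S → IsForcingSet k D S → m ≤ card S

-- m ≤ MOF_k(G) for G the complete multipartite graph given by `part`:
-- some orientation D has F_k(D) ≥ m.
MOFAtLeast : {N q : ℕ} → ℕ → (Fin N → Fin q) → ℕ → Set
MOFAtLeast k part m =
  ∃ λ D → IsOrientation part D × FkAtLeast k D m

module Submission where

-- Orient every edge from the part of smaller index to the part of larger
-- index.  Fix a forcing set S and a part V_i.  Along any forcing process
-- started from S, either V_i stays coloured exactly as in S, or some
-- vertex u with part u < i forced; every vertex of V_i is then an
-- out-neighbour of u, so at that moment (when V_i was still coloured as
-- in S) at most k vertices of V_i were outside S.  A vertex forcing into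
-- V₀ would need part u < 0, so V₀ is never touched and V₀ ⊆ S.  Summing
-- |S ∩ V_i| over the parts gives the bound.  The ordering n₀ ≥ n₁ ≥ …
-- only serves to make the bound best possible; the argument does not use it.

open import Defs
open import Data.Nat using (ℕ; suc; _≤_; _∸_; _+_)
open import Data.Fin using (Fin; zero) renaming (suc to fsuc; _≤_ to _≤ᶠ_)

import Data.Fin as F
open import Data.Fin.Properties using (_≟_; _<?_; <-irrefl; <-asym; <-cmp)
open import Data.Nat using (zero; z≤n)
open import Data.Nat.Properties
  using (≤-refl; ≤-trans; ≤-reflexive; +-mono-≤; ∸-monoʳ-≤; m+n∸n≡m; m∸n≤m; +-0-commutativeMonoid; module ≤-Reasoning)
open import Data.Nat.ListAction using (sum)
open import Data.List using (tabulate)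
open import Data.List.Properties using (map-tabulate)
open import Algebra.Properties.CommutativeMonoid.Sum +-0-commutativeMonoid
  using (sum-cong-≗; sum-replicate-zero; ∑-distrib-+; ∑-comm)
  renaming (sum to ∑)
open import Data.Bool using (Bool; true; false; not; _∧_; _∨_)
open import Data.Bool.Properties using (∨-identityʳ; ∧-zeroʳ; ∧-comm)
open import Data.Product using (_,_)
open import Data.Sum using (_⊎_; inj₁; inj₂)
open import Data.Empty using (⊥-elim)
open import Function using (_∘_; id)
open import Relation.Nullary using (Dec; does; yes; no; ¬_)
open import Relation.Nullary.Decidable using (dec-true; dec-false)
open import Relation.Binary using (tri<; tri≈; tri>)
open import Relation.Binary.PropositionalEquality
open import Relation.Binary.Construct.Closure.ReflexiveTransitive using (Star; fold)

does-true : ∀ {A : Set} (d : Dec A) → does d ≡ true → A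
does-true (yes a) _ = a
does-true (no _) ()

sum-tabulate : ∀ m (f : Fin m → ℕ) → sum (tabulate f) ≡ ∑ f
sum-tabulate zero    f = refl
sum-tabulate (suc m) f = cong (f zero +_) (sum-tabulate m (f ∘ fsuc))

Σᶠ≡∑ : ∀ m (f : Fin m → ℕ) → Σᶠ m f ≡ ∑ f
Σᶠ≡∑ m f = trans (cong sum (map-tabulate id f)) (sum-tabulate m f)

∑-mono : ∀ m (f g : Fin m → ℕ) → (∀ x → f x ≤ g x) → ∑ f ≤ ∑ g
∑-mono zero    f g f≤g = z≤n
∑-mono (suc m) f g f≤g = +-mono-≤ (f≤g zero) (∑-mono m (f ∘ fsuc) (g ∘ fsuc) (f≤g ∘ fsuc))

Σᶠ-mono : ∀ m (f g : Fin m → ℕ) → (∀ x → f x ≤ g x) → Σᶠ m f ≤ Σᶠ m g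
Σᶠ-mono m f g f≤g =
  ≤-trans (≤-reflexive (Σᶠ≡∑ m f)) (≤-trans (∑-mono m f g f≤g) (≤-reflexive (sym (Σᶠ≡∑ m g))))

Σᶠ-suc : ∀ m (f : Fin (suc m) → ℕ) → Σᶠ (suc m) f ≡ f zero + Σᶠ m (f ∘ fsuc)
Σᶠ-suc m f = trans (Σᶠ≡∑ (suc m) f) (cong (f zero +_) (sym (Σᶠ≡∑ m (f ∘ fsuc))))

-- Summing the indicator of "i = x" over all i gives 1; masking it by a
-- Boolean b gives b.  This lets a vertex be counted through its part.
∑-point : ∀ {q} (x : Fin q) → ∑ (λ i → Bool→ℕ (does (x ≟ i))) ≡ 1
∑-point {suc q} zero     = cong suc (sum-replicate-zero q)
∑-point         (fsuc x) = ∑-point x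

∑-masked-point : ∀ {q} (b : Bool) (x : Fin q) → ∑ (λ i → Bool→ℕ (b ∧ does (x ≟ i))) ≡ Bool→ℕ b
∑-masked-point {q} false x = sum-replicate-zero q
∑-masked-point     true  x = ∑-point x

_∩_ : ∀ {N} → (Fin N → Bool) → (Fin N → Bool) → (Fin N → Bool)
(P ∩ Q) v = P v ∧ Q v

_∖_ : ∀ {N} → (Fin N → Bool) → (Fin N → Bool) → (Fin N → Bool)
(P ∖ Q) v = P v ∧ not (Q v)

card≡∑ : ∀ {N} (P : Fin N → Bool) → card P ≡ ∑ (λ v → Bool→ℕ (P v))
card≡∑ {N} P = Σᶠ≡∑ N (λ v → Bool→ℕ (P v))

card-cong : ∀ {N} (P Q : Fin N → Bool) → (∀ v → P v ≡ Q v) → card P ≡ card Q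
card-cong P Q P≗Q = trans (card≡∑ P) (trans (sum-cong-≗ (cong Bool→ℕ ∘ P≗Q)) (sym (card≡∑ Q)))

card-mono : ∀ {N} (P Q : Fin N → Bool) → (∀ v → P v ≡ true → Q v ≡ true) → card P ≤ card Q
card-mono P Q P⊆Q = Σᶠ-mono _ _ _ (λ v → indicator-mono (P v) (Q v) (P⊆Q v))
  where
  indicator-mono : ∀ p q → (p ≡ true → q ≡ true) → Bool→ℕ p ≤ Bool→ℕ q
  indicator-mono false q _   = z≤n
  indicator-mono true  q p⇒q rewrite p⇒q refl = ≤-refl

card-split : ∀ {N} (P Q : Fin N → Bool) → card P ≡ card (P ∩ Q) + card (P ∖ Q)
card-split {N} P Q = begin
    card P                                    ≡⟨ card≡∑ P ⟩
    ∑ (λ v → Bool→ℕ (P v))                    ≡⟨ sum-cong-≗ (λ v → split (P v) (Q v)) ⟩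
    ∑ (λ v → Bool→ℕ ((P ∩ Q) v) + Bool→ℕ ((P ∖ Q) v))  ≡⟨ ∑-distrib-+ (λ v → Bool→ℕ ((P ∩ Q) v)) (λ v → Bool→ℕ ((P ∖ Q) v)) ⟩
    ∑ (λ v → Bool→ℕ ((P ∩ Q) v)) + ∑ (λ v → Bool→ℕ ((P ∖ Q) v))
                                              ≡⟨ sym (cong₂ _+_ (card≡∑ (P ∩ Q)) (card≡∑ (P ∖ Q))) ⟩
    card (P ∩ Q) + card (P ∖ Q)               ∎
  where
  open ≡-Reasoning
  split : ∀ p q → Bool→ℕ p ≡ Bool→ℕ (p ∧ q) + Bool→ℕ (p ∧ not q)
  split false _     = refl
  split true  false = refl
  split true  true  = refl

module Parts {N q : ℕ} (part : Fin N → Fin q) where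

  inPart : Fin q → Fin N → Bool
  inPart i v = does (part v ≟ i)

  inPart-true : ∀ i v → inPart i v ≡ true → part v ≡ i
  inPart-true i v = does-true (part v ≟ i)

  card-by-parts : (S : Fin N → Bool) → card S ≡ Σᶠ q (λ i → card (S ∩ inPart i))
  card-by-parts S = begin
      card S                                                ≡⟨ card≡∑ S ⟩
      ∑ (λ v → Bool→ℕ (S v))                                ≡⟨ sum-cong-≗ (λ v → sym (∑-masked-point (S v) (part v))) ⟩
      ∑ (λ v → ∑ (λ i → Bool→ℕ ((S ∩ inPart i) v)))         ≡⟨ ∑-comm (λ v i → Bool→ℕ ((S ∩ inPart i) v)) ⟩
      ∑ (λ i → ∑ (λ v → Bool→ℕ ((S ∩ inPart i) v)))         ≡⟨ sym (sum-cong-≗ (λ i → card≡∑ (S ∩ inPart i))) ⟩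
      ∑ (λ i → card (S ∩ inPart i))                         ≡⟨ sym (Σᶠ≡∑ q (λ i → card (S ∩ inPart i))) ⟩
      Σᶠ q (λ i → card (S ∩ inPart i))                      ∎
    where open ≡-Reasoning

  ordered : Fin N → Fin N → Bool
  ordered u v = does (part u <? part v)

  ordered-isOrientation : IsOrientation part ordered
  ordered-isOrientation = between-parts , one-direction
    where
    between-parts : ∀ u v → ordered u v ≡ true → part u ≢ part v
    between-parts u v arc same = <-irrefl same (does-true (part u <? part v) arc)
    one-direction : ∀ u v → part u ≢ part v → ordered u v ≡ not (ordered v u)
    one-direction u v different with <-cmp (part u) (part v)
    ... | tri< u<v _ _ = trans (dec-true (part u <? part v) u<v)
                               (cong not (sym (dec-false (part v <? part u) (<-asym u<v))))
    ... | tri≈ _ same _ = ⊥-elim (different same)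
    ... | tri> _ _ v<u = trans (dec-false (part u <? part v) (<-asym v<u))
                               (cong not (sym (dec-true (part v <? part u) v<u)))

  ordered-into : ∀ {u} i v → inPart i v ≡ true → part u F.< i → ordered u v ≡ true
  ordered-into {u} i v v∈i u<i =
    dec-true (part u <? part v) (subst (part u F.<_) (sym (inPart-true i v v∈i)) u<i)

  ordered-not-into : ∀ {u} i v → inPart i v ≡ true → ¬ part u F.< i → ordered u v ≡ false
  ordered-not-into {u} i v v∈i u≮i =
    dec-false (part u <? part v) (u≮i ∘ subst (part u F.<_) (inPart-true i v v∈i))

  module Process (k : ℕ) (S : Fin N → Bool) where

    Untouched : Fin q → (Fin N → Bool) → Set
    Untouched i C = ∀ v → inPart i v ≡ true → C v ≡ S v

    untouched-preserved : ∀ {C} u i → ¬ part u F.< i → Untouched i C → Untouched i (force ordered C u)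
    untouched-preserved {C} u i u≮i untouched v v∈i =
      trans (cong (C v ∨_) (ordered-not-into i v v∈i u≮i)) (trans (∨-identityʳ (C v)) (untouched v v∈i))

    missing-bounded : ∀ {C} u i → part u F.< i → Untouched i C →
                      card (inPart i ∖ S) ≤ uncoloredOut ordered C u
    missing-bounded {C} u i u<i untouched = card-mono (inPart i ∖ S) (λ v → ordered u v ∧ not (C v)) witness
      where
      witness : ∀ v → (inPart i ∖ S) v ≡ true → (ordered u v ∧ not (C v)) ≡ true
      witness v missing with inPart i v in v∈i
      witness v missing | true =
        trans (cong₂ _∧_ (ordered-into i v v∈i u<i) (cong not (untouched v v∈i))) missing
      witness v ()      | false

    PartInvariant : Fin q → (Fin N → Bool) → Set
    PartInvariant i C = Untouched i C ⊎ card (inPart i ∖ S) ≤ k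

    -- One forcing step preserves the invariant: a force from an earlier
    -- part certifies the bound, any other force leaves part i untouched.
    invariant-step : ∀ i {C C′} → ForceStep k ordered C C′ → PartInvariant i C → PartInvariant i C′
    invariant-step i (u , _ , _    , refl) (inj₂ few)       = inj₂ few
    invariant-step i (u , _ , cost , refl) (inj₁ untouched) with part u <? i
    ... | yes u<i = inj₂ (≤-trans (missing-bounded u i u<i untouched) cost)
    ... | no  u≮i = inj₁ (untouched-preserved u i u≮i untouched)

    along : (P : (Fin N → Bool) → Set) → (∀ {C C′} → ForceStep k ordered C C′ → P C → P C′) →
            ∀ {C C′} → Star (ForceStep k ordered) C C′ → P C → P C′
    along P step = fold (λ C C′ → P C → P C′) (λ s rest → rest ∘ step s) id

    untouched-covered : ∀ {C} i → Untouched i C → (∀ v → C v ≡ true) → ∀ v → inPart i v ≡ true → S v ≡ true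
    untouched-covered i untouched all-coloured v v∈i = trans (sym (untouched v v∈i)) (all-coloured v)

    forcing-set-per-part : IsForcingSet k ordered S → ∀ i →
                           (∀ v → inPart i v ≡ true → S v ≡ true) ⊎ card (inPart i ∖ S) ≤ k
    forcing-set-per-part (C , process , all-coloured) i
      with along (PartInvariant i) (invariant-step i) process (inj₁ (λ _ _ → refl))
    ... | inj₁ untouched = inj₁ (untouched-covered i untouched all-coloured)
    ... | inj₂ few       = inj₂ few

  module Counting (n : Fin q → ℕ) (sizes : HasPartSizes part n) (S : Fin N → Bool) where

    part-covered : ∀ i → (∀ v → inPart i v ≡ true → S v ≡ true) → card (S ∩ inPart i) ≡ n i
    part-covered i covered = trans (card-cong (S ∩ inPart i) (inPart i) absorb) (sizes i)
      where
      absorb : ∀ v → S v ∧ inPart i v ≡ inPart i v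
      absorb v with inPart i v in v∈i
      ... | true  = cong (_∧ true) (covered v v∈i)
      ... | false = ∧-zeroʳ (S v)

    part-almost-covered : ∀ {k} i → card (inPart i ∖ S) ≤ k → n i ∸ k ≤ card (S ∩ inPart i)
    part-almost-covered {k} i few = begin
        n i ∸ k                                         ≤⟨ ∸-monoʳ-≤ (n i) few ⟩
        n i ∸ card (inPart i ∖ S)                       ≡⟨ cong (_∸ card (inPart i ∖ S)) n-split ⟩
        card (S ∩ inPart i) + card (inPart i ∖ S) ∸ card (inPart i ∖ S)
                                                        ≡⟨ m+n∸n≡m (card (S ∩ inPart i)) (card (inPart i ∖ S)) ⟩
        card (S ∩ inPart i)                             ∎
      where
      open ≤-Reasoning
      n-split : n i ≡ card (S ∩ inPart i) + card (inPart i ∖ S)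
      n-split = trans (sym (sizes i))
                      (trans (card-split (inPart i) S)
                             (cong (_+ card (inPart i ∖ S)) (card-cong _ _ (λ v → ∧-comm (inPart i v) (S v)))))

    part-lower-bound : ∀ {k} i → (∀ v → inPart i v ≡ true → S v ≡ true) ⊎ card (inPart i ∖ S) ≤ k →
                       n i ∸ k ≤ card (S ∩ inPart i)
    part-lower-bound {k} i (inj₁ covered) = ≤-trans (m∸n≤m (n i) k) (≤-reflexive (sym (part-covered i covered)))
    part-lower-bound     i (inj₂ few)     = part-almost-covered i few

-- In the ordered orientation the first part is never entered by a force,
-- so every forcing set contains it.
first-part-in-forcing-set : ∀ {N r} k (part : Fin N → Fin (suc r)) (S : Fin N → Bool) →
  IsForcingSet k (Parts.ordered part) S → ∀ v → Parts.inPart part zero v ≡ true → S v ≡ true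
first-part-in-forcing-set k part S (C , process , all-coloured) =
  untouched-covered zero (along (Untouched zero) step process (λ _ _ → refl)) all-coloured
  where
  open Parts part
  open Process k S
  step : ∀ {C C′} → ForceStep k ordered C C′ → Untouched zero C → Untouched zero C′
  step (u , _ , _ , refl) = untouched-preserved u zero (λ ())

theorem12 : (k : ℕ) → 1 ≤ k →
    (r : ℕ) → 1 ≤ r →
    (n : Fin (suc r) → ℕ) →
    (∀ i → 1 ≤ n i) →
    (∀ i j → i ≤ᶠ j → n j ≤ n i) →
    (N : ℕ) → (part : Fin N → Fin (suc r)) → HasPartSizes part n →
    MOFAtLeast k part (n zero + Σᶠ r (λ j → n (fsuc j) ∸ k))
theorem12 k _ r _ n _ _ N part sizes = ordered , ordered-isOrientation , bound
  where
  open Parts part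
  bound : FkAtLeast k ordered (n zero + Σᶠ r (λ j → n (fsuc j) ∸ k))
  bound S forcing = ≤-trans
    (+-mono-≤ (≤-reflexive (sym (part-covered zero (first-part-in-forcing-set k part S forcing))))
              (Σᶠ-mono r _ _ (λ j → part-lower-bound (fsuc j) (forcing-set-per-part forcing (fsuc j)))))
    (≤-reflexive (sym (trans (card-by-parts S) (Σᶠ-suc r _))))
    where
    open Process k S
    open Counting n sizes S
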